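{- Let $H=(V,E)$ be an oriented hypergraph, with integer coefficients. The following are equivalent: (i) $H_1$ and $H^1$ are canonically isomorphic; (ii) the annihilator $\{\psi\in C^1:\psi(x)=0\ \forall x\in\operatorname{Ker}\partial_1\}$ of $\operatorname{Ker}\partial_1$ in $C^1$ equals $\operatorname{Im}\delta^0$; (iii) $\mathcal B=\mathcal C^\perp$; (iv) $\operatorname{Im}\partial_1$ is a direct summand of $C_0$; (v) the map $[\psi]\mapsto\psi|_{\operatorname{Ker}\partial_1}$ is an isomorphism $H^1\to\mathrm{Hom}(H_1,\mathbb Z)$.
   Context: An oriented hypergraph $H=(V,E)$ consists of a finite set $V$ and a set $E$ of ordered pairs $(A,B)$ of disjoint subsets of $V$, where $E$ never contains both $(A,B)$ and $(B,A)$. $C_0,C_1$ are the free $\mathbb Z$-modules with bases $V,E$; $\partial_1\colon C_1\to C_0$ is the linear extension of $(A,B)\mapsto\sum_{v\in B}v-\sum_{v\in A}v$; $C^0=\mathrm{Hom}(C_0,\mathbb Z)$, $C^1=\mathrm{Hom}(C_1,\mathbb Z)$; $\delta^0(\varphi)=\varphi\circ\partial_1$. $H_1:=\operatorname{Ker}\partial_1$, $H^1:=C^1/\operatorname{Im}\delta^0$. $\gamma_1\colon C_1\to C^1$ with $\gamma_1(e)(e')=\delta_{ee'}$; $\langle\,,\rangle$ is the bilinear form on $C_1$ with $\langle e,e'\rangle=\delta_{ee'}$; $\mathcal C:=\operatorname{Ker}\partial_1$, $\mathcal B:=\gamma_1^{ -1}(\operatorname{Im}\delta^0)$, $\mathcal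 C^\perp:=\{y\in C_1:\langle x,y\rangle=0\ \forall x\in\mathcal C\}$. Let $i\colon\operatorname{Ker}\partial_1\to C_1$ be the inclusion and $i^*\colon C^1\to(\operatorname{Ker}\partial_1)^*=\mathrm{Hom}(\operatorname{Ker}\partial_1,\mathbb Z)$, $\psi\mapsto\psi\circ i$. "$H_1$ and $H^1$ are canonically isomorphic" means that $\operatorname{Ker} i^*=\operatorname{Im}\delta^0$ and $i^*$ is surjective, so that one obtains the chain of isomorphisms $H_1=\operatorname{Ker}\partial_1\cong(\operatorname{Ker}\partial_1)^*=\operatorname{Im} i^*\cong C^1/\operatorname{Ker} i^*=C^1/\operatorname{Im}\delta^0=H^1$, using the map $C^1/\operatorname{Ker} i^*\to\operatorname{Im} i^*$, $[\psi]\mapsto\psi|_{\operatorname{Ker}\partial_1}$, and any isomorphism $\operatorname{Ker}\partial_1\cong(\operatorname{Ker}\partial_1)^*$. -}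

module Defs where

open import Data.Nat using (ℕ; zero; suc)
open import Data.Integer using (ℤ; _+_; _*_; -_; _-_) renaming (0ℤ to 0z; 1ℤ to 1z)
open import Data.Bool using (Bool; true; false; if_then_else_)
open import Data.Fin using (Fin)
open import Data.Fin.Subset using (Subset; _∩_; Empty)
open import Data.Vec using (Vec; []; _∷_; lookup; tabulate; zipWith; replicate)
open import Data.Product using (Σ; _×_; _,_; proj₁; proj₂; ∃; ∃-syntax; swap)
open import Relation.Binary.PropositionalEquality using (_≡_; _≢_)
open import Function.Bundles using (_⇔_)
open import Level using (Level; suc) renaming (zero to lzero)

record OrientedHypergraph : Set where
  field
    n m      : ℕ
    edge     : Fin m → Subset n × Subset n
    disjoint : ∀ e → Empty (proj₁ (edge e) ∩ proj₂ (edge e))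
    distinct : ∀ e e′ → edge e ≡ edge e′ → e ≡ e′
    noRev    : ∀ e e′ → edge e′ ≢ swap (edge e)

sumℤ : ∀ {k} → Vec ℤ k → ℤ
sumℤ []       = 0z
sumℤ (x ∷ xs) = x + sumℤ xs

⟨_,_⟩ : ∀ {k} → Vec ℤ k → Vec ℤ k → ℤ
⟨ x , y ⟩ = sumℤ (zipWith _*_ x y)

_+ᵛ_ : ∀ {k} → Vec ℤ k → Vec ℤ k → Vec ℤ k
_+ᵛ_ = zipWith _+_

_-ᵛ_ : ∀ {k} → Vec ℤ k → Vec ℤ k → Vec ℤ k
_-ᵛ_ = zipWith _-_

_·ᵛ_ : ∀ {k} → ℤ → Vec ℤ k → Vec ℤ k
c ·ᵛ x = Data.Vec.map (c *_) x
  where import Data.Vec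

0ᵛ : ∀ {k} → Vec ℤ k
0ᵛ = replicate _ 0z

-- C^0 = Hom(C₀,ℤ), C^1 = Hom(C₁,ℤ): a homomorphism out of a free module
-- with finite basis is the same as its vector of values on the basis,
-- so ψ ∈ C^1 is represented by (ψ(e))_e and ψ(x) = ⟨ ψ , x ⟩.

module _ (H : OrientedHypergraph) where
  open OrientedHypergraph H

  C₀ C₁ C⁰ C¹ : Set
  C₀ = Vec ℤ n
  C₁ = Vec ℤ m
  C⁰ = Vec ℤ n
  C¹ = Vec ℤ m

  ev : C¹ → C₁ → ℤ
  ev ψ x = ⟨ ψ , x ⟩

  -- coefficient of vertex v in ∂₁(e) = Σ_{v∈B} v − Σ_{v∈A} v
  inc : Fin m → Fin n → ℤ
  inc e v = if lookup (proj₂ (edge e)) v then 1z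
            else (if lookup (proj₁ (edge e)) v then - 1z else 0z)

  ∂₁ : C₁ → C₀
  ∂₁ x = tabulate (λ v → sumℤ (tabulate (λ e → lookup x e * inc e v)))

  -- δ⁰(φ) = φ ∘ ∂₁, as values on the basis E
  δ⁰ : C⁰ → C¹
  δ⁰ φ = tabulate (λ e → ⟨ φ , tabulate (λ v → inc e v) ⟩)

  -- γ₁ : C₁ → C¹, γ₁(e)(e') = δ_{ee'}; on coordinates it is the identity
  γ₁ : C₁ → C¹
  γ₁ y = y

  InKer∂₁ : C₁ → Set
  InKer∂₁ x = ∂₁ x ≡ 0ᵛ

  -- Ker ∂₁ = H₁ as a subgroup of C₁
  Ker∂₁ : Set
  Ker∂₁ = Σ C₁ InKer∂₁

  InIm∂₁ : C₀ → Set
  InIm∂₁ y = ∃[ x ] ∂₁ x ≡ y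

  InImδ⁰ : C¹ → Set
  InImδ⁰ ψ = ∃[ φ ] δ⁰ φ ≡ ψ

  -- (Ker ∂₁)* = Hom(Ker ∂₁ , ℤ): group homomorphisms (= ℤ-linear maps)
  record KerDual : Set where
    field
      fun   : (x : C₁) → InKer∂₁ x → ℤ
      hom-+ : ∀ x y (px : InKer∂₁ x) (py : InKer∂₁ y) (pxy : InKer∂₁ (x +ᵛ y)) →
              fun (x +ᵛ y) pxy ≡ fun x px + fun y py

  -- i* ψ = ψ ∘ i ; two elements of (Ker ∂₁)* are equal iff pointwise equal
  RestrictsTo : C¹ → KerDual → Set
  RestrictsTo ψ f = ∀ x (p : InKer∂₁ x) → ev ψ x ≡ KerDual.fun f x p

  InKeri* : C¹ → Set
  InKeri* ψ = ∀ x → InKer∂₁ x → ev ψ x ≡ 0z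

  InAnn : C¹ → Set
  InAnn ψ = ∀ x → InKer∂₁ x → ev ψ x ≡ 0z

  In𝓑 : C₁ → Set
  In𝓑 y = InImδ⁰ (γ₁ y)

  In𝓒⊥ : C₁ → Set
  In𝓒⊥ y = ∀ x → InKer∂₁ x → ⟨ x , y ⟩ ≡ 0z

  -- (i) H₁ and H¹ canonically isomorphic: Ker i* = Im δ⁰ and i* surjective
  CanonIso : Set
  CanonIso = (∀ ψ → InKeri* ψ ⇔ InImδ⁰ ψ) × (∀ f → ∃[ ψ ] RestrictsTo ψ f)

  AnnEqIm : Set
  AnnEqIm = ∀ ψ → InAnn ψ ⇔ InImδ⁰ ψ

  BEqC⊥ : Set
  BEqC⊥ = ∀ y → In𝓑 y ⇔ In𝓒⊥ y

record Submodule (k : ℕ) : Set₁ where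
  field
    Carrier : Vec ℤ k → Set
    has-0   : Carrier 0ᵛ
    has-+   : ∀ {x y} → Carrier x → Carrier y → Carrier (x +ᵛ y)
    has-·   : ∀ c {x} → Carrier x → Carrier (c ·ᵛ x)

module _ (H : OrientedHypergraph) where
  open OrientedHypergraph H

  ImDirectSummand : Set₁
  ImDirectSummand =
    Σ (Submodule n) λ N →
      (∀ v → ∃[ a ] ∃[ b ] (InIm∂₁ H a × Submodule.Carrier N b × v ≡ a +ᵛ b))
      × (∀ v → InIm∂₁ H v → Submodule.Carrier N v → v ≡ 0ᵛ)

  -- (v) [ψ] ↦ ψ|_{Ker ∂₁} is an isomorphism H¹ = C¹/Im δ⁰ → Hom(H₁,ℤ).
  -- (It is always well defined, since Im δ⁰ restricts to 0 on Ker ∂₁.)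
  -- Bijectivity on the quotient: injective modulo Im δ⁰, and surjective.
  RestrIso : Set
  RestrIso =
    (∀ ψ ψ′ → (∀ x → InKer∂₁ H x → ev H ψ x ≡ ev H ψ′ x) → InImδ⁰ H (ψ -ᵛ ψ′))
    × (∀ f → ∃[ ψ ] RestrictsTo H ψ f)

-- Everything reduces to integer linear algebra for the additive map ∂ = ∂₁ : ℤ^E → ℤ^V and its
-- adjoint δ = δ⁰, ⟨ δ φ , x ⟩ = ⟨ φ , ∂ x ⟩.  The kernel of any additive map between free modules
-- of finite rank is a retract of the domain: for a single row a, Bézout gives a = d·c and
-- ⟨ a , x₀ ⟩ = d with d the gcd of the entries, and x ↦ x − ⟨ c , x ⟩·x₀ retracts onto the kernel
-- of ⟨ a , - ⟩; the rows are then handled one after another.  Hence every homomorphism Ker ∂ → ℤ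
-- extends to ℤ^E, so i* is always onto and (i) ⇔ (ii).  An annihilator ψ of Ker ∂ induces a
-- functional on Im ∂, and ψ ∈ Im δ exactly when this functional extends to ℤ^V; extending all of
-- them at once amounts to an additive retraction of ℤ^V onto Im ∂, whose kernel is a complement of
-- Im ∂, so (ii) ⇔ (iv).  Condition (iii) is (ii) read through the symmetry of ⟨ , ⟩, and the
-- injectivity in (v) is (ii) applied to ψ − ψ′.

module Submission where

open import Defs
open import Data.Nat as ℕ using (ℕ; zero; suc)
import Data.Nat.Properties as ℕ
open import Data.Nat.Divisibility using (divides)
open import Data.Nat.GCD using (module GCD; module Bézout)
open import Data.Integer using (ℤ; ≢-nonZero; +_; -[1+_]; _+_; _*_; -_; _-_) renaming (0ℤ to 0z; 1ℤ to 1z)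
import Data.Integer.Properties as ℤ
open import Data.Integer.Tactic.RingSolver using (solve-∀)
open import Algebra.Properties.AbelianGroup ℤ.+-0-abelianGroup using (inverseˡ-unique; x≈y⇒x∙y⁻¹≈ε)
open import Data.Fin using (Fin; zero; suc)
open import Data.Vec using (Vec; []; _∷_; lookup; tabulate; tail)
open import Data.Vec.Properties
  using (≡-dec; tabulate∘lookup; lookup∘tabulate; tabulate-cong; lookup-zipWith; lookup-map; lookup-replicate)
open import Data.Product using (Σ; _×_; _,_; ∃-syntax; proj₁; proj₂)
open import Function using (_∘_; id)
open import Function.Bundles using (Equivalence; _⇔_; mk⇔)
open import Function.Properties.Equivalence using () renaming (trans to ⇔-trans; sym to ⇔-sym)
open import Relation.Nullary using (Dec; yes; no)
open import Relation.Binary.PropositionalEquality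
open import Axiom.UniquenessOfIdentityProofs using (module Decidable⇒UIP)

private
  variable
    k l p : ℕ

record IntegerBézout (a b : ℤ) : Set where
  field
    gcd u v a′ b′ : ℤ
    identity : gcd ≡ u * a + v * b
    a≡gcd*a′ : a ≡ gcd * a′
    b≡gcd*b′ : b ≡ gcd * b′

pos-+-* : ∀ d y n x m → d ℕ.+ y ℕ.* n ≡ x ℕ.* m → + d + + y * + n ≡ + x * + m
pos-+-* d y n x m eq = begin
  + d + + y * + n   ≡⟨ cong (λ t → + d + t) (ℤ.pos-* y n) ⟨
  + d + + (y ℕ.* n) ≡⟨ ℤ.pos-+ d (y ℕ.* n) ⟨
  + (d ℕ.+ y ℕ.* n) ≡⟨ cong +_ eq ⟩
  + (x ℕ.* m)       ≡⟨ ℤ.pos-* x m ⟩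
  + x * + m         ∎
  where open ≡-Reasoning

bézoutℕ : ∀ m n → IntegerBézout (+ m) (+ n)
bézoutℕ m n with Bézout.lemma m n
... | Bézout.result d (GCD.is (divides p m≡pd , divides q n≡qd) _) identity = fromIdentity identity
  where
  pos-divides : ∀ {k r} → k ≡ r ℕ.* d → + k ≡ + d * + r
  pos-divides {k} {r} k≡rd = trans (cong +_ (trans k≡rd (ℕ.*-comm r d))) (ℤ.pos-* d r)

  withCoefficients : ∀ u v → + d ≡ u * + m + v * + n → IntegerBézout (+ m) (+ n)
  withCoefficients u v d≡um+vn = record
    { gcd = + d ; u = u ; v = v ; a′ = + p ; b′ = + q ; identity = d≡um+vn
    ; a≡gcd*a′ = pos-divides m≡pd ; b≡gcd*b′ = pos-divides n≡qd
    }

  d≡[d+yn]-yn : ∀ d y n → d ≡ (d + y * n) + (- y) * n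
  d≡[d+yn]-yn = solve-∀

  d≡-xm+[d+xm] : ∀ d x m → d ≡ (- x) * m + (d + x * m)
  d≡-xm+[d+xm] = solve-∀

  fromIdentity : Bézout.Identity d m n → IntegerBézout (+ m) (+ n)
  fromIdentity (Bézout.+- x y eq) = withCoefficients (+ x) (- + y)
    (trans (d≡[d+yn]-yn (+ d) (+ y) (+ n)) (cong (_+ (- + y) * + n) (pos-+-* d y n x m eq)))
  fromIdentity (Bézout.-+ x y eq) = withCoefficients (- + x) (+ y)
    (trans (d≡-xm+[d+xm] (+ d) (+ x) (+ m)) (cong (λ t → (- + x) * + m + t) (pos-+-* d x m y n eq)))

module _ {a b : ℤ} (β : IntegerBézout a b) where
  open IntegerBézout β

  negateˡ : IntegerBézout (- a) b
  negateˡ = record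
    { gcd = gcd ; u = - u ; v = v ; a′ = - a′ ; b′ = b′
    ; identity = trans identity (cong (_+ v * b) (neg-*-neg u a))
    ; a≡gcd*a′ = trans (cong -_ a≡gcd*a′) (ℤ.neg-distribʳ-* gcd a′)
    ; b≡gcd*b′ = b≡gcd*b′
    }
    where
    neg-*-neg : ∀ u a → u * a ≡ (- u) * (- a)
    neg-*-neg = solve-∀

  swap : IntegerBézout b a
  swap = record
    { gcd = gcd ; u = v ; v = u ; a′ = b′ ; b′ = a′
    ; identity = trans identity (ℤ.+-comm (u * a) (v * b))
    ; a≡gcd*a′ = b≡gcd*b′ ; b≡gcd*b′ = a≡gcd*a′
    }

negateʳ : {a b : ℤ} → IntegerBézout a b → IntegerBézout a (- b)
negateʳ β = swap (negateˡ (swap β))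

integerBézout : ∀ a b → IntegerBézout a b
integerBézout (+ m)    (+ n)    = bézoutℕ m n
integerBézout (+ m)    -[1+ n ] = negateʳ (bézoutℕ m (suc n))
integerBézout -[1+ m ] (+ n)    = negateˡ (bézoutℕ (suc m) n)
integerBézout -[1+ m ] -[1+ n ] = negateˡ (negateʳ (bézoutℕ (suc m) (suc n)))

lookup-ext : {x y : Vec ℤ k} → (∀ i → lookup x i ≡ lookup y i) → x ≡ y
lookup-ext {x = x} {y} x≗y = begin
  x                   ≡⟨ tabulate∘lookup x ⟨
  tabulate (lookup x) ≡⟨ tabulate-cong x≗y ⟩
  tabulate (lookup y) ≡⟨ tabulate∘lookup y ⟩
  y                   ∎
  where open ≡-Reasoning

lookup-+ᵛ : ∀ (x y : Vec ℤ k) i → lookup (x +ᵛ y) i ≡ lookup x i + lookup y i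
lookup-+ᵛ x y i = lookup-zipWith _+_ i x y

lookup--ᵛ : ∀ (x y : Vec ℤ k) i → lookup (x -ᵛ y) i ≡ lookup x i - lookup y i
lookup--ᵛ x y i = lookup-zipWith _-_ i x y

lookup-·ᵛ : ∀ c (x : Vec ℤ k) i → lookup (c ·ᵛ x) i ≡ c * lookup x i
lookup-·ᵛ c x i = lookup-map i (c *_) x

lookup-0ᵛ : ∀ (i : Fin k) → lookup 0ᵛ i ≡ 0z
lookup-0ᵛ i = lookup-replicate i 0z

tabulate-+ᵛ : ∀ (f g : Fin k → ℤ) → tabulate (λ i → f i + g i) ≡ tabulate f +ᵛ tabulate g
tabulate-+ᵛ {zero}  f g = refl
tabulate-+ᵛ {suc k} f g = cong (f zero + g zero ∷_) (tabulate-+ᵛ (f ∘ suc) (g ∘ suc))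

+ᵛ-identityˡ : ∀ (x : Vec ℤ k) → 0ᵛ +ᵛ x ≡ x
+ᵛ-identityˡ []       = refl
+ᵛ-identityˡ (x ∷ xs) = cong₂ _∷_ (ℤ.+-identityˡ x) (+ᵛ-identityˡ xs)

+ᵛ-identityʳ : ∀ (x : Vec ℤ k) → x +ᵛ 0ᵛ ≡ x
+ᵛ-identityʳ []       = refl
+ᵛ-identityʳ (x ∷ xs) = cong₂ _∷_ (ℤ.+-identityʳ x) (+ᵛ-identityʳ xs)

+ᵛ-interchange : ∀ (w x y z : Vec ℤ k) → (w +ᵛ x) +ᵛ (y +ᵛ z) ≡ (w +ᵛ y) +ᵛ (x +ᵛ z)
+ᵛ-interchange []       []       []       []       = refl
+ᵛ-interchange (w ∷ ws) (x ∷ xs) (y ∷ ys) (z ∷ zs) =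
  cong₂ _∷_ (interchange w x y z) (+ᵛ-interchange ws xs ys zs)
  where
  interchange : ∀ w x y z → (w + x) + (y + z) ≡ (w + y) + (x + z)
  interchange = solve-∀

-ᵛ-+ᵛ-interchange : ∀ (w x y z : Vec ℤ k) → (w +ᵛ x) -ᵛ (y +ᵛ z) ≡ (w -ᵛ y) +ᵛ (x -ᵛ z)
-ᵛ-+ᵛ-interchange []       []       []       []       = refl
-ᵛ-+ᵛ-interchange (w ∷ ws) (x ∷ xs) (y ∷ ys) (z ∷ zs) =
  cong₂ _∷_ (interchange w x y z) (-ᵛ-+ᵛ-interchange ws xs ys zs)
  where
  interchange : ∀ w x y z → (w + x) - (y + z) ≡ (w - y) + (x - z)
  interchange = solve-∀

x-ᵛx≡0ᵛ : ∀ (x : Vec ℤ k) → x -ᵛ x ≡ 0ᵛ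
x-ᵛx≡0ᵛ []       = refl
x-ᵛx≡0ᵛ (x ∷ xs) = cong₂ _∷_ (ℤ.+-inverseʳ x) (x-ᵛx≡0ᵛ xs)

x-ᵛ0ᵛ≡x : ∀ (x : Vec ℤ k) → x -ᵛ 0ᵛ ≡ x
x-ᵛ0ᵛ≡x []       = refl
x-ᵛ0ᵛ≡x (x ∷ xs) = cong₂ _∷_ (ℤ.+-identityʳ x) (x-ᵛ0ᵛ≡x xs)

x≡y+ᵛ[x-ᵛy] : ∀ (x y : Vec ℤ k) → x ≡ y +ᵛ (x -ᵛ y)
x≡y+ᵛ[x-ᵛy] []       []       = refl
x≡y+ᵛ[x-ᵛy] (x ∷ xs) (y ∷ ys) = cong₂ _∷_ (x≡y+[x-y] x y) (x≡y+ᵛ[x-ᵛy] xs ys)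
  where
  x≡y+[x-y] : ∀ x y → x ≡ y + (x - y)
  x≡y+[x-y] = solve-∀

x-ᵛy≡x+ᵛ-1·ᵛy : ∀ (x y : Vec ℤ k) → x -ᵛ y ≡ x +ᵛ ((- 1z) ·ᵛ y)
x-ᵛy≡x+ᵛ-1·ᵛy []       []       = refl
x-ᵛy≡x+ᵛ-1·ᵛy (x ∷ xs) (y ∷ ys) =
  cong₂ _∷_ (cong (λ t → x + t) (sym (ℤ.-1*i≡-i y))) (x-ᵛy≡x+ᵛ-1·ᵛy xs ys)

x-ᵛy≡0ᵛ⇒x≡y : {x y : Vec ℤ k} → x -ᵛ y ≡ 0ᵛ → x ≡ y
x-ᵛy≡0ᵛ⇒x≡y {x = x} {y} x-y≡0 = lookup-ext λ i → ℤ.i-j≡0⇒i≡j _ _ (begin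
  lookup x i - lookup y i ≡⟨ lookup--ᵛ x y i ⟨
  lookup (x -ᵛ y) i       ≡⟨ cong (λ z → lookup z i) x-y≡0 ⟩
  lookup 0ᵛ i             ≡⟨ lookup-0ᵛ i ⟩
  0z                      ∎)
  where open ≡-Reasoning

a+ᵛb≡c+ᵛd⇒a-ᵛc≡d-ᵛb : {a b c d : Vec ℤ k} → a +ᵛ b ≡ c +ᵛ d → a -ᵛ c ≡ d -ᵛ b
a+ᵛb≡c+ᵛd⇒a-ᵛc≡d-ᵛb {a = a} {b} {c} {d} eq = lookup-ext λ i → begin
  lookup (a -ᵛ c) i                                     ≡⟨ lookup--ᵛ a c i ⟩
  lookup a i - lookup c i                               ≡⟨ add-b (lookup a i) (lookup b i) (lookup c i) ⟩
  (lookup a i + lookup b i) - (lookup c i + lookup b i) ≡⟨ cong (_- (lookup c i + lookup b i)) (eqᵢ i) ⟩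
  (lookup c i + lookup d i) - (lookup c i + lookup b i) ≡⟨ cancel-c (lookup c i) _ _ ⟩
  lookup d i - lookup b i                               ≡⟨ lookup--ᵛ d b i ⟨
  lookup (d -ᵛ b) i                                     ∎
  where
  open ≡-Reasoning
  eqᵢ : ∀ i → lookup a i + lookup b i ≡ lookup c i + lookup d i
  eqᵢ i = trans (sym (lookup-+ᵛ a b i)) (trans (cong (λ v → lookup v i) eq) (lookup-+ᵛ c d i))
  add-b : ∀ a b c → a - c ≡ (a + b) - (c + b)
  add-b = solve-∀
  cancel-c : ∀ c d b → (c + d) - (c + b) ≡ d - b
  cancel-c = solve-∀

·ᵛ-zeroˡ : ∀ (x : Vec ℤ k) → 0z ·ᵛ x ≡ 0ᵛ
·ᵛ-zeroˡ []       = refl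
·ᵛ-zeroˡ (x ∷ xs) = cong (0z ∷_) (·ᵛ-zeroˡ xs)

·ᵛ-zeroʳ : ∀ c → c ·ᵛ 0ᵛ {k} ≡ 0ᵛ
·ᵛ-zeroʳ {zero}  c = refl
·ᵛ-zeroʳ {suc k} c = cong₂ _∷_ (ℤ.*-zeroʳ c) (·ᵛ-zeroʳ c)

·ᵛ-identityˡ : ∀ (x : Vec ℤ k) → 1z ·ᵛ x ≡ x
·ᵛ-identityˡ []       = refl
·ᵛ-identityˡ (x ∷ xs) = cong₂ _∷_ (ℤ.*-identityˡ x) (·ᵛ-identityˡ xs)

·ᵛ-distribʳ-+ : ∀ a b (x : Vec ℤ k) → (a + b) ·ᵛ x ≡ (a ·ᵛ x) +ᵛ (b ·ᵛ x)
·ᵛ-distribʳ-+ a b []       = refl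
·ᵛ-distribʳ-+ a b (x ∷ xs) = cong₂ _∷_ (ℤ.*-distribʳ-+ x a b) (·ᵛ-distribʳ-+ a b xs)

·ᵛ-assoc : ∀ a b (x : Vec ℤ k) → (a * b) ·ᵛ x ≡ a ·ᵛ (b ·ᵛ x)
·ᵛ-assoc a b []       = refl
·ᵛ-assoc a b (x ∷ xs) = cong₂ _∷_ (ℤ.*-assoc a b x) (·ᵛ-assoc a b xs)

⟨⟩-comm : ∀ (x y : Vec ℤ k) → ⟨ x , y ⟩ ≡ ⟨ y , x ⟩
⟨⟩-comm []       []       = refl
⟨⟩-comm (x ∷ xs) (y ∷ ys) = cong₂ _+_ (ℤ.*-comm x y) (⟨⟩-comm xs ys)

⟨⟩-distribˡ-+ᵛ : ∀ (x y z : Vec ℤ k) → ⟨ x , y +ᵛ z ⟩ ≡ ⟨ x , y ⟩ + ⟨ x , z ⟩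
⟨⟩-distribˡ-+ᵛ []       []       []       = refl
⟨⟩-distribˡ-+ᵛ (x ∷ xs) (y ∷ ys) (z ∷ zs) =
  trans (cong (λ t → x * (y + z) + t) (⟨⟩-distribˡ-+ᵛ xs ys zs)) (distrib x y z ⟨ xs , ys ⟩ ⟨ xs , zs ⟩)
  where
  distrib : ∀ x y z s t → x * (y + z) + (s + t) ≡ (x * y + s) + (x * z + t)
  distrib = solve-∀

⟨⟩-distribʳ-+ᵛ : ∀ (x y z : Vec ℤ k) → ⟨ y +ᵛ z , x ⟩ ≡ ⟨ y , x ⟩ + ⟨ z , x ⟩
⟨⟩-distribʳ-+ᵛ x y z = begin
  ⟨ y +ᵛ z , x ⟩          ≡⟨ ⟨⟩-comm (y +ᵛ z) x ⟩
  ⟨ x , y +ᵛ z ⟩          ≡⟨ ⟨⟩-distribˡ-+ᵛ x y z ⟩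
  ⟨ x , y ⟩ + ⟨ x , z ⟩   ≡⟨ cong₂ _+_ (⟨⟩-comm x y) (⟨⟩-comm x z) ⟩
  ⟨ y , x ⟩ + ⟨ z , x ⟩   ∎
  where open ≡-Reasoning

⟨⟩-zeroʳ : ∀ (x : Vec ℤ k) → ⟨ x , 0ᵛ ⟩ ≡ 0z
⟨⟩-zeroʳ []       = refl
⟨⟩-zeroʳ (x ∷ xs) = cong₂ _+_ (ℤ.*-zeroʳ x) (⟨⟩-zeroʳ xs)

basis : Fin k → Vec ℤ k
basis zero    = 1z ∷ 0ᵛ
basis (suc i) = 0z ∷ basis i

⟨⟩-basis : ∀ (x : Vec ℤ k) i → ⟨ x , basis i ⟩ ≡ lookup x i
⟨⟩-basis (x ∷ xs) zero    = trans (cong₂ _+_ (ℤ.*-identityʳ x) (⟨⟩-zeroʳ xs)) (ℤ.+-identityʳ x)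
⟨⟩-basis (x ∷ xs) (suc i) = trans (cong₂ _+_ (ℤ.*-zeroʳ x) (⟨⟩-basis xs i)) (ℤ.+-identityˡ (lookup xs i))

⟨⟩-ext : {u w : Vec ℤ k} → (∀ x → ⟨ u , x ⟩ ≡ ⟨ w , x ⟩) → u ≡ w
⟨⟩-ext {u = u} {w} u≗w = lookup-ext λ i →
  trans (sym (⟨⟩-basis u i)) (trans (u≗w (basis i)) (⟨⟩-basis w i))

record IsAdditiveFunctional (φ : Vec ℤ k → ℤ) : Set where
  field
    +ᵛ-homo : ∀ x y → φ (x +ᵛ y) ≡ φ x + φ y

  0ᵛ-homo : φ 0ᵛ ≡ 0z
  0ᵛ-homo = begin
    φ 0ᵛ                 ≡⟨ a≡[a+a]-a (φ 0ᵛ) ⟩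
    (φ 0ᵛ + φ 0ᵛ) - φ 0ᵛ ≡⟨ cong (_- φ 0ᵛ) (+ᵛ-homo 0ᵛ 0ᵛ) ⟨
    φ (0ᵛ +ᵛ 0ᵛ) - φ 0ᵛ  ≡⟨ cong (λ z → φ z - φ 0ᵛ) (+ᵛ-identityˡ 0ᵛ) ⟩
    φ 0ᵛ - φ 0ᵛ          ≡⟨ ℤ.+-inverseʳ (φ 0ᵛ) ⟩
    0z                   ∎
    where
    open ≡-Reasoning
    a≡[a+a]-a : ∀ a → a ≡ (a + a) - a
    a≡[a+a]-a = solve-∀

  -ᵛ-homo : ∀ x y → φ (x -ᵛ y) ≡ φ x - φ y
  -ᵛ-homo x y = begin
    φ (x -ᵛ y)                  ≡⟨ c≡[b+c]-b (φ y) (φ (x -ᵛ y)) ⟩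
    (φ y + φ (x -ᵛ y)) - φ y    ≡⟨ cong (_- φ y) (+ᵛ-homo y (x -ᵛ y)) ⟨
    φ (y +ᵛ (x -ᵛ y)) - φ y     ≡⟨ cong (λ z → φ z - φ y) (x≡y+ᵛ[x-ᵛy] x y) ⟨
    φ x - φ y                   ∎
    where
    open ≡-Reasoning
    c≡[b+c]-b : ∀ b c → c ≡ (b + c) - b
    c≡[b+c]-b = solve-∀

  private
    +-·ᵛ-homo : ∀ a b x → φ ((a + b) ·ᵛ x) ≡ φ (a ·ᵛ x) + φ (b ·ᵛ x)
    +-·ᵛ-homo a b x = trans (cong φ (·ᵛ-distribʳ-+ a b x)) (+ᵛ-homo (a ·ᵛ x) (b ·ᵛ x))

    ℕ-·ᵛ-homo : ∀ n x → φ ((+ n) ·ᵛ x) ≡ + n * φ x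
    ℕ-·ᵛ-homo zero    x = trans (cong φ (·ᵛ-zeroˡ x)) 0ᵛ-homo
    ℕ-·ᵛ-homo (suc n) x = begin
      φ ((1z + + n) ·ᵛ x)            ≡⟨ +-·ᵛ-homo 1z (+ n) x ⟩
      φ (1z ·ᵛ x) + φ ((+ n) ·ᵛ x)   ≡⟨ cong₂ _+_ (cong φ (·ᵛ-identityˡ x)) (ℕ-·ᵛ-homo n x) ⟩
      φ x + + n * φ x                ≡⟨ ℤ.suc-* (+ n) (φ x) ⟨
      + suc n * φ x                  ∎
      where open ≡-Reasoning

  ·ᵛ-homo : ∀ c x → φ (c ·ᵛ x) ≡ c * φ x
  ·ᵛ-homo (+ n)    x = ℕ-·ᵛ-homo n x
  ·ᵛ-homo -[1+ n ] x = begin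
    φ (-[1+ n ] ·ᵛ x)      ≡⟨ inverseˡ-unique _ _ cancels ⟩
    - φ ((+ suc n) ·ᵛ x)   ≡⟨ cong -_ (ℕ-·ᵛ-homo (suc n) x) ⟩
    - (+ suc n * φ x)      ≡⟨ ℤ.neg-distribˡ-* (+ suc n) (φ x) ⟩
    -[1+ n ] * φ x         ∎
    where
    open ≡-Reasoning
    cancels : φ (-[1+ n ] ·ᵛ x) + φ ((+ suc n) ·ᵛ x) ≡ 0z
    cancels = begin
      φ (-[1+ n ] ·ᵛ x) + φ ((+ suc n) ·ᵛ x) ≡⟨ +-·ᵛ-homo -[1+ n ] (+ suc n) x ⟨
      φ ((-[1+ n ] + + suc n) ·ᵛ x)          ≡⟨ cong (λ c → φ (c ·ᵛ x)) (ℤ.+-inverseˡ (+ suc n)) ⟩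
      φ (0z ·ᵛ x)                            ≡⟨ ℕ-·ᵛ-homo 0 x ⟩
      0z                                     ∎

coefficients : (Vec ℤ k → ℤ) → Vec ℤ k
coefficients φ = tabulate (φ ∘ basis)

representation : {φ : Vec ℤ k → ℤ} → IsAdditiveFunctional φ → ∀ x → φ x ≡ ⟨ coefficients φ , x ⟩
representation additive [] = IsAdditiveFunctional.0ᵛ-homo additive
representation {φ = φ} additive (x ∷ xs) = begin
  φ (x ∷ xs)                                               ≡⟨ cong φ x∷xs≡x·e₀+0∷xs ⟩
  φ ((x ·ᵛ basis zero) +ᵛ (0z ∷ xs))                       ≡⟨ IsAdditiveFunctional.+ᵛ-homo additive _ _ ⟩
  φ (x ·ᵛ basis zero) + φ (0z ∷ xs)                        ≡⟨ cong₂ _+_ head-term (representation tail-additive xs) ⟩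
  φ (basis zero) * x + ⟨ coefficients (φ ∘ (0z ∷_)) , xs ⟩ ∎
  where
  open ≡-Reasoning
  x∷xs≡x·e₀+0∷xs : x ∷ xs ≡ (x ·ᵛ basis zero) +ᵛ (0z ∷ xs)
  x∷xs≡x·e₀+0∷xs = sym (cong₂ _∷_ (trans (ℤ.+-identityʳ (x * 1z)) (ℤ.*-identityʳ x))
                                   (trans (cong (_+ᵛ xs) (·ᵛ-zeroʳ x)) (+ᵛ-identityˡ xs)))
  head-term : φ (x ·ᵛ basis zero) ≡ φ (basis zero) * x
  head-term = trans (IsAdditiveFunctional.·ᵛ-homo additive x (basis zero)) (ℤ.*-comm x _)
  tail-additive : IsAdditiveFunctional (φ ∘ (0z ∷_))
  tail-additive = record { +ᵛ-homo = λ y z → IsAdditiveFunctional.+ᵛ-homo additive (0z ∷ y) (0z ∷ z) }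

record IsAdditive (F : Vec ℤ k → Vec ℤ l) : Set where
  field
    +ᵛ-homo : ∀ x y → F (x +ᵛ y) ≡ F x +ᵛ F y

  coordinate : ∀ i → IsAdditiveFunctional (λ x → lookup (F x) i)
  coordinate i = record
    { +ᵛ-homo = λ x y → trans (cong (λ z → lookup z i) (+ᵛ-homo x y)) (lookup-+ᵛ (F x) (F y) i) }

  0ᵛ-homo : F 0ᵛ ≡ 0ᵛ
  0ᵛ-homo = lookup-ext λ i →
    trans (IsAdditiveFunctional.0ᵛ-homo (coordinate i)) (sym (lookup-0ᵛ i))

  -ᵛ-homo : ∀ x y → F (x -ᵛ y) ≡ F x -ᵛ F y
  -ᵛ-homo x y = lookup-ext λ i →
    trans (IsAdditiveFunctional.-ᵛ-homo (coordinate i) x y) (sym (lookup--ᵛ (F x) (F y) i))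

  ·ᵛ-homo : ∀ c x → F (c ·ᵛ x) ≡ c ·ᵛ F x
  ·ᵛ-homo c x = lookup-ext λ i →
    trans (IsAdditiveFunctional.·ᵛ-homo (coordinate i) c x) (sym (lookup-·ᵛ c (F x) i))

tabulate-additive : {φ : Fin l → Vec ℤ k → ℤ} → (∀ i → IsAdditiveFunctional (φ i)) →
                    IsAdditive (λ x → tabulate (λ i → φ i x))
tabulate-additive additive = record { +ᵛ-homo = λ x y →
  trans (tabulate-cong λ i → IsAdditiveFunctional.+ᵛ-homo (additive i) x y) (tabulate-+ᵛ _ _) }

⟨⟩-additiveʳ : ∀ (x : Vec ℤ k) → IsAdditiveFunctional (λ y → ⟨ x , y ⟩)
⟨⟩-additiveʳ x = record { +ᵛ-homo = ⟨⟩-distribˡ-+ᵛ x }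

⟨⟩-additiveˡ : ∀ (y : Vec ℤ k) → IsAdditiveFunctional (λ x → ⟨ x , y ⟩)
⟨⟩-additiveˡ y = record { +ᵛ-homo = λ x z → ⟨⟩-distribʳ-+ᵛ y x z }

∘-additive : {F : Vec ℤ l → Vec ℤ p} {G : Vec ℤ k → Vec ℤ l} →
             IsAdditive F → IsAdditive G → IsAdditive (F ∘ G)
∘-additive {F = F} {G} F-additive G-additive = record { +ᵛ-homo = λ x y →
  trans (cong F (IsAdditive.+ᵛ-homo G-additive x y)) (IsAdditive.+ᵛ-homo F-additive (G x) (G y)) }

record VectorGcd (a : Vec ℤ k) : Set where
  field
    gcd               : ℤ
    quotient bézout   : Vec ℤ k
    a≡gcd·quotient    : a ≡ gcd ·ᵛ quotient
    ⟨a,bézout⟩≡gcd    : ⟨ a , bézout ⟩ ≡ gcd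

vectorGcd : ∀ (a : Vec ℤ k) → VectorGcd a
vectorGcd []       = record
  { gcd = 0z ; quotient = [] ; bézout = [] ; a≡gcd·quotient = refl ; ⟨a,bézout⟩≡gcd = refl }
vectorGcd (a ∷ as) = record
  { gcd = gcd
  ; quotient = a′ ∷ (b′ ·ᵛ G.quotient)
  ; bézout = u ∷ (v ·ᵛ G.bézout)
  ; a≡gcd·quotient = cong₂ _∷_ a≡gcd*a′ as≡gcd·b′·q
  ; ⟨a,bézout⟩≡gcd = ⟨a∷as,u∷v·bézout⟩≡gcd
  }
  where
  module G = VectorGcd (vectorGcd as)
  module ⟨as,-⟩ = IsAdditiveFunctional (⟨⟩-additiveʳ as)
  open IntegerBézout (integerBézout a G.gcd)
  open ≡-Reasoning
  as≡gcd·b′·q : as ≡ gcd ·ᵛ (b′ ·ᵛ G.quotient)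
  as≡gcd·b′·q = begin
    as                        ≡⟨ G.a≡gcd·quotient ⟩
    G.gcd ·ᵛ G.quotient       ≡⟨ cong (_·ᵛ G.quotient) b≡gcd*b′ ⟩
    (gcd * b′) ·ᵛ G.quotient  ≡⟨ ·ᵛ-assoc gcd b′ G.quotient ⟩
    gcd ·ᵛ (b′ ·ᵛ G.quotient) ∎
  ⟨a∷as,u∷v·bézout⟩≡gcd : a * u + ⟨ as , v ·ᵛ G.bézout ⟩ ≡ gcd
  ⟨a∷as,u∷v·bézout⟩≡gcd = begin
    a * u + ⟨ as , v ·ᵛ G.bézout ⟩ ≡⟨ cong (λ t → a * u + t) (⟨as,-⟩.·ᵛ-homo v G.bézout) ⟩
    a * u + v * ⟨ as , G.bézout ⟩  ≡⟨ cong (λ t → a * u + v * t) G.⟨a,bézout⟩≡gcd ⟩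
    a * u + v * G.gcd              ≡⟨ cong (_+ v * G.gcd) (ℤ.*-comm a u) ⟩
    u * a + v * G.gcd              ≡⟨ identity ⟨
    gcd                            ∎

record Retraction (P : Vec ℤ k → Set) : Set where
  field
    retract  : Vec ℤ k → Vec ℤ k
    additive : IsAdditive retract
    retract∈ : ∀ x → P (retract x)
    fixes    : ∀ {x} → P x → retract x ≡ x

functionalKernelRetraction : {φ : Vec ℤ k → ℤ} → IsAdditiveFunctional φ → Retraction (λ x → φ x ≡ 0z)
functionalKernelRetraction {k} {φ} additive = retraction (gcd ℤ.≟ 0z)
  where
  open VectorGcd (vectorGcd (coefficients φ))
  open IsAdditiveFunctional additive
  open ≡-Reasoning

  φ≡gcd*⟨quotient,⟩ : ∀ x → φ x ≡ gcd * ⟨ quotient , x ⟩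
  φ≡gcd*⟨quotient,⟩ x = begin
    φ x                        ≡⟨ representation additive x ⟩
    ⟨ coefficients φ , x ⟩     ≡⟨ cong ⟨_, x ⟩ a≡gcd·quotient ⟩
    ⟨ gcd ·ᵛ quotient , x ⟩    ≡⟨ IsAdditiveFunctional.·ᵛ-homo (⟨⟩-additiveˡ x) gcd quotient ⟩
    gcd * ⟨ quotient , x ⟩     ∎

  φ[bézout]≡gcd : φ bézout ≡ gcd
  φ[bézout]≡gcd = trans (representation additive bézout) ⟨a,bézout⟩≡gcd

  retraction : Dec (gcd ≡ 0z) → Retraction (λ x → φ x ≡ 0z)
  retraction (yes gcd≡0) = record
    { retract  = id
    ; additive = record { +ᵛ-homo = λ _ _ → refl }
    ; retract∈ = λ x → trans (φ≡gcd*⟨quotient,⟩ x) (cong (_* ⟨ quotient , x ⟩) gcd≡0)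
    ; fixes    = λ _ → refl
    }
  retraction (no gcd≢0) = record
    { retract  = R
    ; additive = R-additive
    ; retract∈ = φ∘R≡0
    ; fixes    = R-fixes
    }
    where
    t : Vec ℤ k → ℤ
    t x = ⟨ quotient , x ⟩

    R : Vec ℤ k → Vec ℤ k
    R x = x -ᵛ (t x ·ᵛ bézout)

    R-additive : IsAdditive R
    R-additive = record { +ᵛ-homo = λ x y → begin
      (x +ᵛ y) -ᵛ (t (x +ᵛ y) ·ᵛ bézout)
        ≡⟨ cong (λ s → (x +ᵛ y) -ᵛ (s ·ᵛ bézout)) (⟨⟩-distribˡ-+ᵛ quotient x y) ⟩
      (x +ᵛ y) -ᵛ ((t x + t y) ·ᵛ bézout)
        ≡⟨ cong ((x +ᵛ y) -ᵛ_) (·ᵛ-distribʳ-+ (t x) (t y) bézout) ⟩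
      (x +ᵛ y) -ᵛ ((t x ·ᵛ bézout) +ᵛ (t y ·ᵛ bézout))
        ≡⟨ -ᵛ-+ᵛ-interchange x y (t x ·ᵛ bézout) (t y ·ᵛ bézout) ⟩
      R x +ᵛ R y ∎ }

    φ∘R≡0 : ∀ x → φ (R x) ≡ 0z
    φ∘R≡0 x = begin
      φ (x -ᵛ (t x ·ᵛ bézout))       ≡⟨ -ᵛ-homo x (t x ·ᵛ bézout) ⟩
      φ x - φ (t x ·ᵛ bézout)        ≡⟨ cong₂ _-_ (φ≡gcd*⟨quotient,⟩ x) (·ᵛ-homo (t x) bézout) ⟩
      gcd * t x - t x * φ bézout     ≡⟨ cong (λ s → gcd * t x - t x * s) φ[bézout]≡gcd ⟩
      gcd * t x - t x * gcd          ≡⟨ cancel gcd (t x) ⟩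
      0z                             ∎
      where
      cancel : ∀ d s → d * s - s * d ≡ 0z
      cancel = solve-∀

    R-fixes : ∀ {x} → φ x ≡ 0z → R x ≡ x
    R-fixes {x} φx≡0 = begin
      x -ᵛ (t x ·ᵛ bézout)  ≡⟨ cong (λ s → x -ᵛ (s ·ᵛ bézout)) tx≡0 ⟩
      x -ᵛ (0z ·ᵛ bézout)   ≡⟨ cong (x -ᵛ_) (·ᵛ-zeroˡ bézout) ⟩
      x -ᵛ 0ᵛ               ≡⟨ x-ᵛ0ᵛ≡x x ⟩
      x                     ∎
      where
      tx≡0 : t x ≡ 0z
      tx≡0 = ℤ.*-cancelˡ-≡ gcd (t x) 0z {{≢-nonZero gcd≢0}}
               (trans (sym (φ≡gcd*⟨quotient,⟩ x)) (trans φx≡0 (sym (ℤ.*-zeroʳ gcd))))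

kernelRetraction : {F : Vec ℤ l → Vec ℤ k} → IsAdditive F → Retraction (λ x → F x ≡ 0ᵛ)
kernelRetraction {k = zero}  {F = F} _ = record
  { retract  = id
  ; additive = record { +ᵛ-homo = λ _ _ → refl }
  ; retract∈ = λ x → empty (F x)
  ; fixes    = λ _ → refl
  }
  where
  empty : (v : Vec ℤ 0) → v ≡ []
  empty [] = refl
kernelRetraction {k = suc k} {F = F} F-additive = record
  { retract  = R₁.retract ∘ R₂.retract
  ; additive = ∘-additive R₁.additive R₂.additive
  ; retract∈ = λ x →
      0ᵛ-by-parts (F (R₁.retract (R₂.retract x))) (R₁.retract∈ (R₂.retract x)) (R₂.retract∈ x)
  ; fixes    = fixes
  }
  where
  module R₁ = Retraction (functionalKernelRetraction (IsAdditive.coordinate F-additive zero))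

  F′ : Vec ℤ _ → Vec ℤ k
  F′ = tail ∘ F ∘ R₁.retract

  F′-additive : IsAdditive F′
  F′-additive = ∘-additive (record { +ᵛ-homo = tail-+ᵛ }) (∘-additive F-additive R₁.additive)
    where
    tail-+ᵛ : ∀ (u v : Vec ℤ (suc k)) → tail (u +ᵛ v) ≡ tail u +ᵛ tail v
    tail-+ᵛ (_ ∷ _) (_ ∷ _) = refl

  module R₂ = Retraction (kernelRetraction F′-additive)

  0ᵛ-by-parts : (v : Vec ℤ (suc k)) → lookup v zero ≡ 0z → tail v ≡ 0ᵛ → v ≡ 0ᵛ
  0ᵛ-by-parts (_ ∷ _) = cong₂ _∷_

  fixes : ∀ {x} → F x ≡ 0ᵛ → R₁.retract (R₂.retract x) ≡ x
  fixes {x} Fx≡0 = begin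
    R₁.retract (R₂.retract x) ≡⟨ cong R₁.retract (R₂.fixes F′x≡0) ⟩
    R₁.retract x              ≡⟨ R₁x≡x ⟩
    x                         ∎
    where
    open ≡-Reasoning
    R₁x≡x : R₁.retract x ≡ x
    R₁x≡x = R₁.fixes (cong (λ v → lookup v zero) Fx≡0)
    F′x≡0 : F′ x ≡ 0ᵛ
    F′x≡0 = cong tail (trans (cong F R₁x≡x) Fx≡0)

-- ∂ and δ are arbitrary functions rather than matrices, so that for ∂ = ∂₁ H and δ = δ⁰ H the
-- predicates below unfold to InKer∂₁ H, InIm∂₁ H, InAnn H, In𝓒⊥ H and InImδ⁰ H.
module Kernel {∂ : Vec ℤ l → Vec ℤ k} (∂-additive : IsAdditive ∂) where
  open IsAdditive ∂-additive

  Ker : Vec ℤ l → Set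
  Ker x = ∂ x ≡ 0ᵛ

  Im : Vec ℤ k → Set
  Im y = ∃[ x ] ∂ x ≡ y

  Ann : Vec ℤ l → Set
  Ann ψ = ∀ x → Ker x → ⟨ ψ , x ⟩ ≡ 0z

  Orthogonal : Vec ℤ l → Set
  Orthogonal y = ∀ x → Ker x → ⟨ x , y ⟩ ≡ 0z

  Ann⇔Orthogonal : ∀ {ψ} → Ann ψ ⇔ Orthogonal ψ
  Ann⇔Orthogonal {ψ} = mk⇔ (λ ann x x∈Ker → trans (⟨⟩-comm x ψ) (ann x x∈Ker))
                           (λ orth x x∈Ker → trans (⟨⟩-comm ψ x) (orth x x∈Ker))

  Ker-+ᵛ : ∀ {x y} → Ker x → Ker y → Ker (x +ᵛ y)
  Ker-+ᵛ {x} {y} x∈Ker y∈Ker = trans (+ᵛ-homo x y) (trans (cong₂ _+ᵛ_ x∈Ker y∈Ker) (+ᵛ-identityˡ 0ᵛ))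

  Ann⇒∂-invariant : ∀ {ψ x x′} → Ann ψ → ∂ x ≡ ∂ x′ → ⟨ ψ , x ⟩ ≡ ⟨ ψ , x′ ⟩
  Ann⇒∂-invariant {ψ} {x} {x′} ann ∂x≡∂x′ = ℤ.i-j≡0⇒i≡j _ _ (begin
    ⟨ ψ , x ⟩ - ⟨ ψ , x′ ⟩ ≡⟨ IsAdditiveFunctional.-ᵛ-homo (⟨⟩-additiveʳ ψ) x x′ ⟨
    ⟨ ψ , x -ᵛ x′ ⟩        ≡⟨ ann (x -ᵛ x′) x-x′∈Ker ⟩
    0z                     ∎)
    where
    open ≡-Reasoning
    x-x′∈Ker : Ker (x -ᵛ x′)
    x-x′∈Ker = trans (-ᵛ-homo x x′) (trans (cong (_-ᵛ ∂ x′) ∂x≡∂x′) (x-ᵛx≡0ᵛ (∂ x′)))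

  extension : (f : ∀ x → Ker x → ℤ) →
              (∀ x y px py pxy → f (x +ᵛ y) pxy ≡ f x px + f y py) →
              ∃[ ψ ] ∀ x p → ⟨ ψ , x ⟩ ≡ f x p
  extension f f-additive = coefficients φ , restricts
    where
    module R = Retraction (kernelRetraction ∂-additive)

    f-cong : ∀ {x y} → x ≡ y → (p : Ker x) (q : Ker y) → f x p ≡ f y q
    f-cong refl p q = cong (f _) (≡-irrelevant p q)
      where open Decidable⇒UIP (≡-dec ℤ._≟_)

    φ : Vec ℤ l → ℤ
    φ x = f (R.retract x) (R.retract∈ x)

    φ-additive : IsAdditiveFunctional φ
    φ-additive = record { +ᵛ-homo = λ x y →
      trans (f-cong (IsAdditive.+ᵛ-homo R.additive x y) _ (Ker-+ᵛ (R.retract∈ x) (R.retract∈ y)))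
            (f-additive _ _ _ _ _) }

    restricts : ∀ x p → ⟨ coefficients φ , x ⟩ ≡ f x p
    restricts x p = trans (sym (representation φ-additive x)) (f-cong (R.fixes p) _ p)

  Im-+ᵛ : ∀ {a b} → Im a → Im b → Im (a +ᵛ b)
  Im-+ᵛ (x , refl) (y , refl) = x +ᵛ y , +ᵛ-homo x y

  Im--ᵛ : ∀ {a b} → Im a → Im b → Im (a -ᵛ b)
  Im--ᵛ (x , refl) (y , refl) = x -ᵛ y , -ᵛ-homo x y

  ImIsDirectSummand : Set₁
  ImIsDirectSummand =
    Σ (Submodule k) λ N →
      (∀ v → ∃[ a ] ∃[ b ] (Im a × Submodule.Carrier N b × v ≡ a +ᵛ b))
      × (∀ v → Im v → Submodule.Carrier N v → v ≡ 0ᵛ)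

  retraction⇒directSummand : Retraction Im → ImIsDirectSummand
  retraction⇒directSummand π = N , decompose , (λ v v∈Im πv≡0 → trans (sym (fixes v∈Im)) πv≡0)
    where
    open Retraction π
    module π = IsAdditive additive

    N : Submodule k
    N = record
      { Carrier = λ v → retract v ≡ 0ᵛ
      ; has-0   = π.0ᵛ-homo
      ; has-+   = λ {x} {y} πx≡0 πy≡0 →
          trans (π.+ᵛ-homo x y) (trans (cong₂ _+ᵛ_ πx≡0 πy≡0) (+ᵛ-identityˡ 0ᵛ))
      ; has-·   = λ c {x} πx≡0 → trans (π.·ᵛ-homo c x) (trans (cong (c ·ᵛ_) πx≡0) (·ᵛ-zeroʳ c))
      }

    decompose : ∀ v → ∃[ a ] ∃[ b ] (Im a × retract b ≡ 0ᵛ × v ≡ a +ᵛ b)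
    decompose v = retract v , v -ᵛ retract v , retract∈ v , π[v-πv]≡0 , x≡y+ᵛ[x-ᵛy] v (retract v)
      where
      π[v-πv]≡0 : retract (v -ᵛ retract v) ≡ 0ᵛ
      π[v-πv]≡0 = begin
        retract (v -ᵛ retract v)            ≡⟨ π.-ᵛ-homo v (retract v) ⟩
        retract v -ᵛ retract (retract v)    ≡⟨ cong (retract v -ᵛ_) (fixes (retract∈ v)) ⟩
        retract v -ᵛ retract v              ≡⟨ x-ᵛx≡0ᵛ (retract v) ⟩
        0ᵛ                                  ∎
        where open ≡-Reasoning

  directSummand⇒retraction : ImIsDirectSummand → Retraction Im
  directSummand⇒retraction (N , decompose , Im∩N≡0) = record
    { retract  = π
    ; additive = record { +ᵛ-homo = π-additive }
    ; retract∈ = π∈Im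
    ; fixes    = λ {v} v∈Im →
        unique (π∈Im v) v∈Im (ρ∈N v) has-0 (trans (sym (v≡π+ρ v)) (sym (+ᵛ-identityʳ v)))
    }
    where
    open Submodule N renaming (Carrier to InN)

    π ρ : Vec ℤ k → Vec ℤ k
    π v = proj₁ (decompose v)
    ρ v = proj₁ (proj₂ (decompose v))

    π∈Im : ∀ v → Im (π v)
    π∈Im v = proj₁ (proj₂ (proj₂ (decompose v)))

    ρ∈N : ∀ v → InN (ρ v)
    ρ∈N v = proj₁ (proj₂ (proj₂ (proj₂ (decompose v))))

    v≡π+ρ : ∀ v → v ≡ π v +ᵛ ρ v
    v≡π+ρ v = proj₂ (proj₂ (proj₂ (proj₂ (decompose v))))

    N--ᵛ : ∀ {x y} → InN x → InN y → InN (x -ᵛ y)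
    N--ᵛ {x} {y} x∈N y∈N = subst InN (sym (x-ᵛy≡x+ᵛ-1·ᵛy x y)) (has-+ x∈N (has-· (- 1z) y∈N))

    unique : ∀ {a a′ b b′} → Im a → Im a′ → InN b → InN b′ → a +ᵛ b ≡ a′ +ᵛ b′ → a ≡ a′
    unique a∈Im a′∈Im b∈N b′∈N eq = x-ᵛy≡0ᵛ⇒x≡y
      (Im∩N≡0 _ (Im--ᵛ a∈Im a′∈Im) (subst InN (sym (a+ᵛb≡c+ᵛd⇒a-ᵛc≡d-ᵛb eq)) (N--ᵛ b′∈N b∈N)))

    π-additive : ∀ x y → π (x +ᵛ y) ≡ π x +ᵛ π y
    π-additive x y =
      unique (π∈Im (x +ᵛ y)) (Im-+ᵛ (π∈Im x) (π∈Im y)) (ρ∈N (x +ᵛ y)) (has-+ (ρ∈N x) (ρ∈N y)) (begin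
      π (x +ᵛ y) +ᵛ ρ (x +ᵛ y)          ≡⟨ v≡π+ρ (x +ᵛ y) ⟨
      x +ᵛ y                             ≡⟨ cong₂ _+ᵛ_ (v≡π+ρ x) (v≡π+ρ y) ⟩
      (π x +ᵛ ρ x) +ᵛ (π y +ᵛ ρ y)       ≡⟨ +ᵛ-interchange (π x) (ρ x) (π y) (ρ y) ⟩
      (π x +ᵛ π y) +ᵛ (ρ x +ᵛ ρ y)       ∎)
      where open ≡-Reasoning

  retraction⇔directSummand : Retraction Im ⇔ ImIsDirectSummand
  retraction⇔directSummand = mk⇔ retraction⇒directSummand directSummand⇒retraction

  module Adjoint {δ : Vec ℤ k → Vec ℤ l} (δ-adjoint : ∀ φ x → ⟨ δ φ , x ⟩ ≡ ⟨ φ , ∂ x ⟩) where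

    Imδ : Vec ℤ l → Set
    Imδ ψ = ∃[ φ ] δ φ ≡ ψ

    Imδ⇒Ann : ∀ {ψ} → Imδ ψ → Ann ψ
    Imδ⇒Ann (φ , refl) x x∈Ker = trans (δ-adjoint φ x) (trans (cong ⟨ φ ,_⟩ x∈Ker) (⟨⟩-zeroʳ φ))

    Ann⊆Imδ : Set
    Ann⊆Imδ = ∀ ψ → Ann ψ → Imδ ψ

    Ann≡Imδ⇔Ann⊆Imδ : (∀ ψ → Ann ψ ⇔ Imδ ψ) ⇔ Ann⊆Imδ
    Ann≡Imδ⇔Ann⊆Imδ = mk⇔ (λ Ann≡Imδ ψ → Equivalence.to (Ann≡Imδ ψ)) (λ Ann⊆Imδ ψ → mk⇔ (Ann⊆Imδ ψ) Imδ⇒Ann)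

    Imδ≡Orthogonal⇔Ann≡Imδ : (∀ y → Imδ y ⇔ Orthogonal y) ⇔ (∀ ψ → Ann ψ ⇔ Imδ ψ)
    Imδ≡Orthogonal⇔Ann≡Imδ = mk⇔ (λ Imδ≡Orth ψ → ⇔-trans Ann⇔Orthogonal (⇔-sym (Imδ≡Orth ψ)))
                                  (λ Ann≡Imδ y → ⇔-trans (⇔-sym (Ann≡Imδ y)) Ann⇔Orthogonal)

    Ann⊆Imδ⇒retraction : Ann⊆Imδ → Retraction Im
    Ann⊆Imδ⇒retraction Ann⊆Imδ = record
      { retract  = ∂ ∘ g
      ; additive = ∘-additive ∂-additive g-additive
      ; retract∈ = λ y → g y , refl
      ; fixes    = λ { (x , refl) → ∂g∂x≡∂x x }
      }
      where
      -- Each coordinate of x ↦ x − R x annihilates Ker ∂; the δ-preimages φ e of these functionals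
      -- are the rows of g, so that g ∘ ∂ = id − R and ∂ ∘ g fixes Im ∂.
      module R = Retraction (kernelRetraction ∂-additive)

      x-Rx-additive : IsAdditive (λ x → x -ᵛ R.retract x)
      x-Rx-additive = record { +ᵛ-homo = λ x y →
        trans (cong ((x +ᵛ y) -ᵛ_) (IsAdditive.+ᵛ-homo R.additive x y)) (-ᵛ-+ᵛ-interchange x y _ _) }

      χ : Fin l → Vec ℤ l → ℤ
      χ e x = lookup (x -ᵛ R.retract x) e

      χ-additive : ∀ e → IsAdditiveFunctional (χ e)
      χ-additive = IsAdditive.coordinate x-Rx-additive

      χ∈Ann : ∀ e → Ann (coefficients (χ e))
      χ∈Ann e x x∈Ker = begin
        ⟨ coefficients (χ e) , x ⟩  ≡⟨ representation (χ-additive e) x ⟨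
        lookup (x -ᵛ R.retract x) e ≡⟨ cong (λ z → lookup (x -ᵛ z) e) (R.fixes x∈Ker) ⟩
        lookup (x -ᵛ x) e           ≡⟨ cong (λ z → lookup z e) (x-ᵛx≡0ᵛ x) ⟩
        lookup 0ᵛ e                 ≡⟨ lookup-0ᵛ e ⟩
        0z                          ∎
        where open ≡-Reasoning

      φ : Fin l → Vec ℤ k
      φ e = proj₁ (Ann⊆Imδ (coefficients (χ e)) (χ∈Ann e))

      g : Vec ℤ k → Vec ℤ l
      g y = tabulate (λ e → ⟨ φ e , y ⟩)

      g-additive : IsAdditive g
      g-additive = tabulate-additive (λ e → ⟨⟩-additiveʳ (φ e))

      g∂x≡x-Rx : ∀ x → g (∂ x) ≡ x -ᵛ R.retract x
      g∂x≡x-Rx x = lookup-ext λ e → begin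
        lookup (g (∂ x)) e             ≡⟨ lookup∘tabulate _ e ⟩
        ⟨ φ e , ∂ x ⟩                  ≡⟨ δ-adjoint (φ e) x ⟨
        ⟨ δ (φ e) , x ⟩                ≡⟨ cong ⟨_, x ⟩ (proj₂ (Ann⊆Imδ (coefficients (χ e)) (χ∈Ann e))) ⟩
        ⟨ coefficients (χ e) , x ⟩     ≡⟨ representation (χ-additive e) x ⟨
        lookup (x -ᵛ R.retract x) e    ∎
        where open ≡-Reasoning

      ∂g∂x≡∂x : ∀ x → ∂ (g (∂ x)) ≡ ∂ x
      ∂g∂x≡∂x x = begin
        ∂ (g (∂ x))               ≡⟨ cong ∂ (g∂x≡x-Rx x) ⟩
        ∂ (x -ᵛ R.retract x)      ≡⟨ -ᵛ-homo x (R.retract x) ⟩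
        ∂ x -ᵛ ∂ (R.retract x)    ≡⟨ cong (∂ x -ᵛ_) (R.retract∈ x) ⟩
        ∂ x -ᵛ 0ᵛ                 ≡⟨ x-ᵛ0ᵛ≡x (∂ x) ⟩
        ∂ x                       ∎
        where open ≡-Reasoning

    retraction⇒Ann⊆Imδ : Retraction Im → Ann⊆Imδ
    retraction⇒Ann⊆Imδ π ψ ann = coefficients χ , ⟨⟩-ext δφ≗ψ
      where
      open Retraction π
      open ≡-Reasoning

      -- s is merely a section of ∂ over the retract, yet ⟨ ψ , s - ⟩ is additive because ψ only
      -- sees its argument modulo Ker ∂.
      s : Vec ℤ k → Vec ℤ l
      s y = proj₁ (retract∈ y)

      ∂s≡π : ∀ y → ∂ (s y) ≡ retract y
      ∂s≡π y = proj₂ (retract∈ y)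

      χ : Vec ℤ k → ℤ
      χ y = ⟨ ψ , s y ⟩

      χ-additive : IsAdditiveFunctional χ
      χ-additive = record { +ᵛ-homo = λ y z →
        trans (Ann⇒∂-invariant {ψ} ann (begin
          ∂ (s (y +ᵛ z))            ≡⟨ ∂s≡π (y +ᵛ z) ⟩
          retract (y +ᵛ z)          ≡⟨ IsAdditive.+ᵛ-homo additive y z ⟩
          retract y +ᵛ retract z    ≡⟨ cong₂ _+ᵛ_ (∂s≡π y) (∂s≡π z) ⟨
          ∂ (s y) +ᵛ ∂ (s z)        ≡⟨ +ᵛ-homo (s y) (s z) ⟨
          ∂ (s y +ᵛ s z)            ∎))
        (⟨⟩-distribˡ-+ᵛ ψ (s y) (s z)) }

      δφ≗ψ : ∀ x → ⟨ δ (coefficients χ) , x ⟩ ≡ ⟨ ψ , x ⟩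
      δφ≗ψ x = begin
        ⟨ δ (coefficients χ) , x ⟩  ≡⟨ δ-adjoint (coefficients χ) x ⟩
        ⟨ coefficients χ , ∂ x ⟩    ≡⟨ representation χ-additive (∂ x) ⟨
        ⟨ ψ , s (∂ x) ⟩             ≡⟨ Ann⇒∂-invariant {ψ} ann (trans (∂s≡π (∂ x)) (fixes (x , refl))) ⟩
        ⟨ ψ , x ⟩                   ∎

    Ann⊆Imδ⇔retraction : Ann⊆Imδ ⇔ Retraction Im
    Ann⊆Imδ⇔retraction = mk⇔ Ann⊆Imδ⇒retraction retraction⇒Ann⊆Imδ

    RestrictionInjective : Set
    RestrictionInjective = ∀ ψ ψ′ → (∀ x → Ker x → ⟨ ψ , x ⟩ ≡ ⟨ ψ′ , x ⟩) → Imδ (ψ -ᵛ ψ′)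

    Ann⊆Imδ⇔restrictionInjective : Ann⊆Imδ ⇔ RestrictionInjective
    Ann⊆Imδ⇔restrictionInjective = mk⇔
      (λ Ann⊆Imδ ψ ψ′ agree → Ann⊆Imδ (ψ -ᵛ ψ′) λ x x∈Ker →
         trans (IsAdditiveFunctional.-ᵛ-homo (⟨⟩-additiveˡ x) ψ ψ′) (x≈y⇒x∙y⁻¹≈ε (agree x x∈Ker)))
      (λ injective ψ ann → subst Imδ (x-ᵛ0ᵛ≡x ψ) (injective ψ 0ᵛ λ x x∈Ker →
         trans (ann x x∈Ker) (sym (IsAdditiveFunctional.0ᵛ-homo (⟨⟩-additiveˡ x)))))

sumℤ-tabulate : ∀ (x : Vec ℤ k) (g : Fin k → ℤ) →
                sumℤ (tabulate (λ e → lookup x e * g e)) ≡ ⟨ x , tabulate g ⟩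
sumℤ-tabulate []       g = refl
sumℤ-tabulate (x ∷ xs) g = cong (λ t → x * g zero + t) (sumℤ-tabulate xs (g ∘ suc))

module Hypergraph (H : OrientedHypergraph) where
  open OrientedHypergraph H
  open ≡-Reasoning

  row : Fin n → Vec ℤ m
  row v = tabulate (λ e → inc H e v)

  ∂₁≡tabulate : ∀ x → ∂₁ H x ≡ tabulate (λ v → ⟨ row v , x ⟩)
  ∂₁≡tabulate x = tabulate-cong λ v → trans (sumℤ-tabulate x (λ e → inc H e v)) (⟨⟩-comm x (row v))

  ∂₁-additive : IsAdditive (∂₁ H)
  ∂₁-additive = record { +ᵛ-homo = λ x y → begin
    ∂₁ H (x +ᵛ y)                                                   ≡⟨ ∂₁≡tabulate (x +ᵛ y) ⟩
    tabulate (λ v → ⟨ row v , x +ᵛ y ⟩)                             ≡⟨ IsAdditive.+ᵛ-homo rows-additive x y ⟩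
    tabulate (λ v → ⟨ row v , x ⟩) +ᵛ tabulate (λ v → ⟨ row v , y ⟩) ≡⟨ cong₂ _+ᵛ_ (∂₁≡tabulate x) (∂₁≡tabulate y) ⟨
    ∂₁ H x +ᵛ ∂₁ H y                                                ∎ }
    where
    rows-additive : IsAdditive (λ x → tabulate (λ v → ⟨ row v , x ⟩))
    rows-additive = tabulate-additive (λ v → ⟨⟩-additiveʳ (row v))

  ∂₁-basis : ∀ e → ∂₁ H (basis e) ≡ tabulate (λ v → inc H e v)
  ∂₁-basis e = trans (∂₁≡tabulate (basis e)) (tabulate-cong λ v →
    trans (⟨⟩-basis (row v) e) (lookup∘tabulate (λ e′ → inc H e′ v) e))

  δ⁰-adjoint : ∀ φ x → ⟨ δ⁰ H φ , x ⟩ ≡ ⟨ φ , ∂₁ H x ⟩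
  δ⁰-adjoint φ x = begin
    ⟨ δ⁰ H φ , x ⟩                                  ≡⟨ cong ⟨_, x ⟩ δ⁰φ≡coefficients ⟩
    ⟨ coefficients (λ y → ⟨ φ , ∂₁ H y ⟩) , x ⟩     ≡⟨ representation φ∘∂₁-additive x ⟨
    ⟨ φ , ∂₁ H x ⟩                                  ∎
    where
    δ⁰φ≡coefficients : δ⁰ H φ ≡ coefficients (λ y → ⟨ φ , ∂₁ H y ⟩)
    δ⁰φ≡coefficients = tabulate-cong λ e → cong ⟨ φ ,_⟩ (sym (∂₁-basis e))
    φ∘∂₁-additive : IsAdditiveFunctional (λ y → ⟨ φ , ∂₁ H y ⟩)
    φ∘∂₁-additive = record { +ᵛ-homo = λ y z →
      trans (cong ⟨ φ ,_⟩ (IsAdditive.+ᵛ-homo ∂₁-additive y z)) (⟨⟩-distribˡ-+ᵛ φ (∂₁ H y) (∂₁ H z)) }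

  open Kernel ∂₁-additive public
  open Adjoint {δ = δ⁰ H} δ⁰-adjoint public

  restriction-surjective : ∀ f → ∃[ ψ ] RestrictsTo H ψ f
  restriction-surjective f = extension (KerDual.fun f) (KerDual.hom-+ f)

theorem14 : (H : OrientedHypergraph) →
    (CanonIso H ⇔ AnnEqIm H) × (AnnEqIm H ⇔ BEqC⊥ H) ×
    (BEqC⊥ H ⇔ ImDirectSummand H) × (ImDirectSummand H ⇔ RestrIso H)
theorem14 H =
    mk⇔ proj₁ (_, restriction-surjective)
  , ⇔-sym Imδ≡Orthogonal⇔Ann≡Imδ
  , ⇔-trans Imδ≡Orthogonal⇔Ann≡Imδ (⇔-trans Ann≡Imδ⇔Ann⊆Imδ Ann⊆Imδ⇔directSummand)
  , ⇔-trans (⇔-sym Ann⊆Imδ⇔directSummand) Ann⊆Imδ⇔restrIso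
  where
  open Hypergraph H

  Ann⊆Imδ⇔directSummand : Ann⊆Imδ ⇔ ImDirectSummand H
  Ann⊆Imδ⇔directSummand = ⇔-trans Ann⊆Imδ⇔retraction retraction⇔directSummand

  Ann⊆Imδ⇔restrIso : Ann⊆Imδ ⇔ RestrIso H
  Ann⊆Imδ⇔restrIso = ⇔-trans Ann⊆Imδ⇔restrictionInjective (mk⇔ (_, restriction-surjective) proj₁)
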